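{- Let $\mathcal{R}=(\mathcal{F},R)$ be a confluent $(\mathbb{\Omega},\mathbb{\Phi})$-TRS, let $t,s$ be terms and $\varepsilon\in\Omega$. If $t\leftrightarrow^*_{R,\varepsilon}s$, then $t\downarrow_{R,\delta}s$ for some $\delta\succsim\varepsilon$; and $t\downarrow_{R,\delta}s$ implies $t\leftrightarrow^*_{R,\delta}s$.
   Context: $\mathbb{\Omega}=(\Omega,\precsim,\otimes,\kappa)$ is a fixed Lawverean quantale (commutative monoid with complete lattice order $\precsim$, $\otimes$ distributing over arbitrary joins, $\kappa$ top, $\kappa\neq\bot$, cointegral); $\delta\succsim\varepsilon$ means $\varepsilon\precsim\delta$. A CBE is a monotone map $\Omega\to\Omega$ preserving $\kappa$, $\otimes$ and arbitrary joins; $\mathbb{\Phi}$ is a fixed set of CBEs containing identity $\mathbb{1}$ and constant $\kappa^\star$, closed under composition and pointwise $\otimes$. A $\mathbb{\Phi}$-graded signature gives each $n$-ary $f$ a modal arity $(\phi_1,\dots,\phi_n)\in\Phi^n$; grade of a position: $\partial_\lambda(t)=\mathbb{1}$, $\partial_{i.p}(f(t_1,\dots,t_n))=\phi_i\circ\partial_p(t_i)$. An $(\mathbb{\Omega},\mathbb{\Phi})$-TRS $\mathcal{R}=(\mathcal{F},R)$: graded signature with rules $\varepsilon\Vdash l\mapsto r$, $l\notin\mathcal{V}$, $\mathcal{V}(r)\subseteq\mathcal{V}(l)$. Rewrite steps $\partial_p(u)(\varepsilon)\Vdash u[l\sigma]_p\to_R u[r\sigma]_p$ for any rule, term $u$,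 position $p$, substitution $\sigma$; write $u\to_{R,\gamma}u'$. $u\leftrightarrow_{R,\gamma}u'$ iff $u\to_{R,\gamma}u'$ or $u'\to_{R,\gamma}u$. $\to^*_{R,\varepsilon}$ and $\leftrightarrow^*_{R,\varepsilon}$: finite sequences of steps (possibly empty, with degree $\kappa$) whose degrees have tensor product $\varepsilon$. $u\downarrow_{R,\varepsilon}u'$ iff there are $\delta_1,\delta_2\in\Omega$ and a term $w$ with $u\to^*_{R,\delta_1}w$, $u'\to^*_{R,\delta_2}w$, $\delta_1\otimes\delta_2=\varepsilon$. $\mathcal{R}$ is confluent if whenever $t\to^*_{R,\varepsilon_1}s_1$ and $t\to^*_{R,\varepsilon_2}s_2$, there is $\delta\succsim\varepsilon_1\otimes\varepsilon_2$ with $s_1\downarrow_{R,\delta}s_2$. -}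

module Defs where

open import Data.Nat using (ℕ)
open import Data.Fin using (Fin; _≟_)
open import Data.Product using (Σ; _×_; _,_)
open import Data.Empty renaming (⊥ to Empty)
open import Relation.Nullary using (¬_; yes; no)
open import Relation.Binary.PropositionalEquality using (_≡_; _≢_)

record LawvereanQuantale : Set₁ where
  infix  4 _≾_
  infixl 7 _⊗_
  field
    Ω        : Set
    _≾_      : Ω → Ω → Set
    ≾-refl   : ∀ {x} → x ≾ x
    ≾-trans  : ∀ {x y z} → x ≾ y → y ≾ z → x ≾ z
    ≾-antisym : ∀ {x y} → x ≾ y → y ≾ x → x ≡ y
    ⋁        : (Ω → Set) → Ω
    ⋁-ub     : ∀ (S : Ω → Set) {x} → S x → x ≾ ⋁ S
    ⋁-least  : ∀ (S : Ω → Set) {y} → (∀ x → S x → x ≾ y) → ⋁ S ≾ y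
    _⊗_      : Ω → Ω → Ω
    κ        : Ω
    ⊗-assoc  : ∀ x y z → (x ⊗ y) ⊗ z ≡ x ⊗ (y ⊗ z)
    ⊗-comm   : ∀ x y → x ⊗ y ≡ y ⊗ x
    ⊗-identityˡ : ∀ x → κ ⊗ x ≡ x
    ⊗-distrib-⋁ : ∀ x (S : Ω → Set) →
                  x ⊗ ⋁ S ≡ ⋁ (λ z → Σ Ω λ y → S y × (z ≡ x ⊗ y))
    κ-top    : ∀ x → x ≾ κ
    κ≢⊥      : κ ≢ ⋁ (λ _ → Empty)

  _≿_ : Ω → Ω → Set
  δ ≿ ε = ε ≾ δ

module _ (Q : LawvereanQuantale) where
  open LawvereanQuantale Q

  -- Joins are preserved for nonempty families (needed so
  -- that the constant map κ⋆ is a CBE).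
  record IsCBE (φ : Ω → Ω) : Set₁ where
    field
      mono   : ∀ {x y} → x ≾ y → φ x ≾ φ y
      pres-κ : φ κ ≡ κ
      pres-⊗ : ∀ x y → φ (x ⊗ y) ≡ φ x ⊗ φ y
      pres-⋁ : ∀ (S : Ω → Set) → Σ Ω S →
               φ (⋁ S) ≡ ⋁ (λ z → Σ Ω λ y → S y × (z ≡ φ y))

  record GradeSet : Set₁ where
    field
      Φ      : (Ω → Ω) → Set
      Φ-CBE  : ∀ {φ} → Φ φ → IsCBE φ
      Φ-id   : Φ (λ x → x)
      Φ-κ⋆   : Φ (λ _ → κ)
      Φ-∘    : ∀ {φ ψ} → Φ φ → Φ ψ → Φ (λ x → φ (ψ x))
      Φ-⊗    : ∀ {φ ψ} → Φ φ → Φ ψ → Φ (λ x → φ x ⊗ ψ x)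

module _ {Q : LawvereanQuantale} (G : GradeSet Q) where
  open LawvereanQuantale Q
  open GradeSet G

  record GradedSignature : Set₁ where
    field
      Sym   : Set
      arity : Sym → ℕ
      modal : (f : Sym) → Fin (arity f) → Ω → Ω
      modal∈Φ : ∀ f i → Φ (modal f i)

module Terms {Q : LawvereanQuantale} {G : GradeSet Q} (Σ' : GradedSignature G) where
  open LawvereanQuantale Q
  open GradedSignature Σ'

  data Term : Set where
    var : ℕ → Term
    app : (f : Sym) → (Fin (arity f) → Term) → Term

  data _occursIn_ (x : ℕ) : Term → Set where
    here  : x occursIn var x
    there : ∀ {f ts} (i : Fin (arity f)) → x occursIn ts i → x occursIn app f ts

  Subst : Set
  Subst = ℕ → Term

  _⟨_⟩ : Term → Subst → Term
  var x    ⟨ σ ⟩ = σ x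
  app f ts ⟨ σ ⟩ = app f (λ i → ts i ⟨ σ ⟩)

  data Pos : Term → Set where
    root  : ∀ {t} → Pos t
    child : ∀ {f ts} (i : Fin (arity f)) → Pos (ts i) → Pos (app f ts)

  _∣_ : (u : Term) → Pos u → Term
  u          ∣ root      = u
  app f ts   ∣ child i p = ts i ∣ p

  _[_]at_ : (u : Term) → Term → Pos u → Term
  u        [ w ]at root = w
  app f ts [ w ]at child i p =
    app f (λ j → replaceAt j (i ≟ j))
    where
      replaceAt : (j : Fin (arity f)) → _ → Term
      replaceAt j (yes _) = ts i [ w ]at p
      replaceAt j (no _)  = ts j

  ∂ : {u : Term} → Pos u → Ω → Ω
  ∂ root          = λ x → x
  ∂ (child {f} i p) = λ x → modal f i (∂ p x)

record TRS {Q : LawvereanQuantale} (G : GradeSet Q) : Set₁ where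
  open LawvereanQuantale Q
  field
    sig  : GradedSignature G
  open Terms sig
  field
    Rule : Set
    deg  : Rule → Ω
    lhs  : Rule → Term
    rhs  : Rule → Term
    lhs-nonvar : ∀ ρ x → lhs ρ ≢ var x
    rhs-vars   : ∀ ρ x → x occursIn rhs ρ → x occursIn lhs ρ

module Rewriting {Q : LawvereanQuantale} {G : GradeSet Q} (𝓡 : TRS G) where
  open LawvereanQuantale Q
  open TRS 𝓡
  open Terms sig public

  record _⟶[_]_ (u : Term) (γ : Ω) (u' : Term) : Set where
    field
      rule  : Rule
      pos   : Pos u
      subst : Subst
      redex : u ∣ pos ≡ lhs rule ⟨ subst ⟩
      result : u' ≡ u [ rhs rule ⟨ subst ⟩ ]at pos
      degree : γ ≡ ∂ pos (deg rule)

  data _⟷[_]_ (u : Term) (γ : Ω) (u' : Term) : Set where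
    fwd : u ⟶[ γ ] u' → u ⟷[ γ ] u'
    bwd : u' ⟶[ γ ] u → u ⟷[ γ ] u'

  data _⟶*[_]_ : Term → Ω → Term → Set where
    done : ∀ {t} → t ⟶*[ κ ] t
    step : ∀ {t t' u γ δ} → t ⟶[ γ ] t' → t' ⟶*[ δ ] u → t ⟶*[ γ ⊗ δ ] u

  data _⟷*[_]_ : Term → Ω → Term → Set where
    done : ∀ {t} → t ⟷*[ κ ] t
    step : ∀ {t t' u γ δ} → t ⟷[ γ ] t' → t' ⟷*[ δ ] u → t ⟷*[ γ ⊗ δ ] u

  _↓[_]_ : Term → Ω → Term → Set
  u ↓[ ε ] u' = Σ Ω λ δ₁ → Σ Ω λ δ₂ → Σ Term λ w →
                (u ⟶*[ δ₁ ] w) × (u' ⟶*[ δ₂ ] w) × (δ₁ ⊗ δ₂ ≡ ε)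

  Confluent : Set
  Confluent = ∀ {t s₁ s₂ ε₁ ε₂} → t ⟶*[ ε₁ ] s₁ → t ⟶*[ ε₂ ] s₂ →
              Σ Ω λ δ → (δ ≿ (ε₁ ⊗ ε₂)) × (s₁ ↓[ δ ] s₂)

{-# OPTIONS --safe #-}
module Submission where

-- A conversion is turned into a joining pair of rewrite sequences by induction on its
-- length: a forward step is simply prepended to the left sequence, while a backward
-- step t ⟵ t' ⟶* w forms a peak that confluence closes as t ⟶* v ⟵* w, after which
-- the right sequence s ⟶* w is extended by w ⟶* v.  Closing a peak can only raise
-- the degree (in ≾), and monotonicity of ⊗, a consequence of its distributivity
-- over joins, propagates these bounds.  Conversely, a joining pair is a conversion since every
-- step can be reversed without changing its degree.

open import Defs
open import Data.Product using (Σ; _×_; _,_)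
open import Data.Sum using (_⊎_; inj₁; inj₂; [_,_])
open import Relation.Binary.Bundles using (Preorder)
open import Relation.Binary.PropositionalEquality
  using (_≡_; refl; sym; trans; cong; subst; isEquivalence)

module QuantaleProperties (Q : LawvereanQuantale) where
  open LawvereanQuantale Q

  ≾-preorder : Preorder _ _ _
  ≾-preorder = record
    { Carrier    = Ω
    ; _≈_        = _≡_
    ; _≲_        = _≾_
    ; isPreorder = record
      { isEquivalence = isEquivalence
      ; reflexive     = λ { refl → ≾-refl }
      ; trans         = ≾-trans
      }
    }

  open import Relation.Binary.Reasoning.Preorder ≾-preorder

  _∨_ : Ω → Ω → Ω
  x ∨ y = ⋁ (λ w → (w ≡ x) ⊎ (w ≡ y))

  ≾⇒∨≡ : ∀ {x y} → x ≾ y → x ∨ y ≡ y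
  ≾⇒∨≡ {x} {y} x≾y = ≾-antisym
    (⋁-least _ (λ w → [ (λ { refl → x≾y }) , (λ { refl → ≾-refl }) ]))
    (⋁-ub _ (inj₂ refl))

  ⊗-identityʳ : ∀ x → x ⊗ κ ≡ x
  ⊗-identityʳ x = trans (⊗-comm x κ) (⊗-identityˡ x)

  ⊗-monoʳ-≾ : ∀ z {x y} → x ≾ y → z ⊗ x ≾ z ⊗ y
  ⊗-monoʳ-≾ z {x} {y} x≾y = begin
    z ⊗ x                                              ∼⟨ ⋁-ub _ (x , inj₁ refl , refl) ⟩
    ⋁ (λ w → Σ Ω λ v → ((v ≡ x) ⊎ (v ≡ y)) × (w ≡ z ⊗ v)) ≡⟨ ⊗-distrib-⋁ z _ ⟨
    z ⊗ (x ∨ y)                                        ≡⟨ cong (z ⊗_) (≾⇒∨≡ x≾y) ⟩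
    z ⊗ y                                              ∎

  ⊗-monoˡ-≾ : ∀ z {x y} → x ≾ y → x ⊗ z ≾ y ⊗ z
  ⊗-monoˡ-≾ z {x} {y} x≾y = begin
    x ⊗ z ≡⟨ ⊗-comm x z ⟩
    z ⊗ x ∼⟨ ⊗-monoʳ-≾ z x≾y ⟩
    z ⊗ y ≡⟨ ⊗-comm z y ⟩
    y ⊗ z ∎

module ConversionProperties {Q : LawvereanQuantale} {G : GradeSet Q} (𝓡 : TRS G) where
  open LawvereanQuantale Q
  open QuantaleProperties Q
  open Rewriting 𝓡

  ⟶*-resp-≡ : ∀ {t u a b} → a ≡ b → t ⟶*[ a ] u → t ⟶*[ b ] u
  ⟶*-resp-≡ {t} {u} = subst (λ c → t ⟶*[ c ] u)

  ⟷*-resp-≡ : ∀ {t u a b} → a ≡ b → t ⟷*[ a ] u → t ⟷*[ b ] u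
  ⟷*-resp-≡ {t} {u} = subst (λ c → t ⟷*[ c ] u)

  ⟶*-trans : ∀ {t u v a b} → t ⟶*[ a ] u → u ⟶*[ b ] v → t ⟶*[ a ⊗ b ] v
  ⟶*-trans done q = ⟶*-resp-≡ (sym (⊗-identityˡ _)) q
  ⟶*-trans (step {γ = γ} {δ} g p) q = ⟶*-resp-≡ (sym (⊗-assoc γ δ _)) (step g (⟶*-trans p q))

  ⟷*-trans : ∀ {t u v a b} → t ⟷*[ a ] u → u ⟷*[ b ] v → t ⟷*[ a ⊗ b ] v
  ⟷*-trans done q = ⟷*-resp-≡ (sym (⊗-identityˡ _)) q
  ⟷*-trans (step {γ = γ} {δ} g p) q = ⟷*-resp-≡ (sym (⊗-assoc γ δ _)) (step g (⟷*-trans p q))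

  ⟷-sym : ∀ {t u γ} → t ⟷[ γ ] u → u ⟷[ γ ] t
  ⟷-sym (fwd g) = bwd g
  ⟷-sym (bwd g) = fwd g

  ⟷*-sym : ∀ {t u a} → t ⟷*[ a ] u → u ⟷*[ a ] t
  ⟷*-sym done = done
  ⟷*-sym (step {γ = γ} {δ} g p) =
    ⟷*-resp-≡ (trans (cong (δ ⊗_) (⊗-identityʳ γ)) (⊗-comm δ γ))
              (⟷*-trans (⟷*-sym p) (step (⟷-sym g) done))

  ⟶*⇒⟷* : ∀ {t u a} → t ⟶*[ a ] u → t ⟷*[ a ] u
  ⟶*⇒⟷* done = done
  ⟶*⇒⟷* (step g p) = step (fwd g) (⟶*⇒⟷* p)

  ↓⇒⟷* : ∀ {t s δ} → t ↓[ δ ] s → t ⟷*[ δ ] s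
  ↓⇒⟷* (_ , _ , _ , p , q , e) = ⟷*-resp-≡ e (⟷*-trans (⟶*⇒⟷* p) (⟷*-sym (⟶*⇒⟷* q)))

  ↓-refl : ∀ {t} → t ↓[ κ ] t
  ↓-refl {t} = κ , κ , t , done , done , ⊗-identityʳ κ

  ⟶-↓ : ∀ {t t' s γ δ} → t ⟶[ γ ] t' → t' ↓[ δ ] s → t ↓[ γ ⊗ δ ] s
  ⟶-↓ {γ = γ} g (a , b , w , p , q , e) =
    γ ⊗ a , b , w , step g p , q , trans (⊗-assoc γ a b) (cong (γ ⊗_) e)

  ↓-⟵* : ∀ {t w s δ b} → t ↓[ δ ] w → s ⟶*[ b ] w → t ↓[ δ ⊗ b ] s
  ↓-⟵* {b = b} (c , d , v , p , q , e) r =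
    c , b ⊗ d , v , p , ⟶*-trans r q ,
    trans (cong (c ⊗_) (⊗-comm b d)) (trans (sym (⊗-assoc c d b)) (cong (_⊗ b) e))

  ⟵-↓ : Confluent → ∀ {t t' s γ δ} → t' ⟶[ γ ] t → t' ↓[ δ ] s →
        Σ Ω λ δ' → (δ' ≿ (γ ⊗ δ)) × (t ↓[ δ' ] s)
  ⟵-↓ conf {γ = γ} g (a , b , w , p , q , refl)
    with conf (step g done) p
  ... | δ'' , peak≾δ'' , t↓w = δ'' ⊗ b , bound , ↓-⟵* t↓w q
    where
      open import Relation.Binary.Reasoning.Preorder ≾-preorder
      bound : γ ⊗ (a ⊗ b) ≾ δ'' ⊗ b
      bound = begin
        γ ⊗ (a ⊗ b)       ≡⟨ ⊗-assoc γ a b ⟨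
        (γ ⊗ a) ⊗ b       ≡⟨ cong (λ x → (x ⊗ a) ⊗ b) (⊗-identityʳ γ) ⟨
        ((γ ⊗ κ) ⊗ a) ⊗ b ∼⟨ ⊗-monoˡ-≾ b peak≾δ'' ⟩
        δ'' ⊗ b           ∎

  ⟷*⇒↓ : Confluent → ∀ {t s ε} → t ⟷*[ ε ] s → Σ Ω λ δ → (δ ≿ ε) × (t ↓[ δ ] s)
  ⟷*⇒↓ conf done = κ , ≾-refl , ↓-refl
  ⟷*⇒↓ conf (step {γ = γ} (fwd g) p) with ⟷*⇒↓ conf p
  ... | δ , ε≾δ , t'↓s = γ ⊗ δ , ⊗-monoʳ-≾ γ ε≾δ , ⟶-↓ g t'↓s
  ⟷*⇒↓ conf (step {γ = γ} (bwd g) p) with ⟷*⇒↓ conf p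
  ... | δ , ε≾δ , t'↓s with ⟵-↓ conf g t'↓s
  ...   | δ' , γδ≾δ' , t↓s = δ' , ≾-trans (⊗-monoʳ-≾ γ ε≾δ) γδ≾δ' , t↓s

lemma2 : (Q : LawvereanQuantale) (G : GradeSet Q) (𝓡 : TRS G) →
         let open LawvereanQuantale Q
             open Rewriting 𝓡
         in Confluent → (t s : Term) →
            (∀ ε → t ⟷*[ ε ] s → Σ Ω λ δ → (δ ≿ ε) × (t ↓[ δ ] s)) ×
            (∀ δ → t ↓[ δ ] s → t ⟷*[ δ ] s)
lemma2 Q G 𝓡 conf t s = (λ _ → ⟷*⇒↓ conf) , (λ _ → ↓⇒⟷*)
  where open ConversionProperties 𝓡
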